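{- Let $Q>1$ be a power of a prime $P$. Consider a finite system of congruences $LQ^e\equiv M\pmod N$, where in each congruence $N$ is taken from a finite set $\mathcal{N}$ of positive integers and $L,M\in\mathbf{Z}$. Suppose that the set of integers $e\ge0$ satisfying all the congruences simultaneously is non-empty. Then, if some congruence of the system has $M\ne0$ with $\mathrm{ord}_PM<\mathrm{ord}_PN$, this set is (a) finite, with $Q^e\le\max_{N\in\mathcal{N}}N$ for every solution $e$; otherwise it is (b) a finite union of arithmetic progressions $e=e_0,e_0+f,e_0+2f,\dots$ with $f=\prod_{N\in\mathcal{N}}\phi(N)$ and $Q^{e_0}<Q^f\max_{N\in\mathcal{N}}N$.
   Context: $\phi$ is Euler's totient function and $\mathrm{ord}_P$ denotes the exponent of $P$ in the prime factorization. -}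

module Defs where

open import Data.Nat using (ℕ; zero; suc; _*_; _^_; _⊔_; _/_)
open import Data.Nat.Divisibility using (_∣?_)
open import Data.Nat.GCD using (gcd)
open import Data.Nat.Properties using (_≟_)
open import Data.List using (List; []; _∷_; foldr; map; filter; length; upTo)
open import Data.Integer as ℤ using (ℤ; ∣_∣)
import Data.Integer.Divisibility as ℤD
open import Data.Product using (_×_)
open import Relation.Nullary using (yes; no)

φ : ℕ → ℕ
φ n = length (filter (λ k → gcd k n ≟ 1) (map suc (upTo n)))

-- P-adic valuation on ℕ, with fuel.  Returns the exponent of p in n
-- (for p ≥ 2 and n ≥ 1); conventionally 0 otherwise.
ordF : ℕ → ℕ → ℕ → ℕ
ordF zero    _             _       = 0
ordF (suc k) (suc (suc q)) (suc m) with suc (suc q) ∣? suc m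
... | yes _ = suc (ordF k (suc (suc q)) (suc m / suc (suc q)))
... | no  _ = 0
ordF (suc k) _             _       = 0

ord : ℕ → ℕ → ℕ
ord p n = ordF n p n

ordℤ : ℕ → ℤ → ℕ
ordℤ p m = ord p ∣ m ∣

maxList : List ℕ → ℕ
maxList = foldr _⊔_ 0

prodList : List ℕ → ℕ
prodList = foldr _*_ 1

-- A congruence  L · Q^e ≡ M (mod N)  is recorded as the triple (L , M , N).
Congruence : Set
Congruence = ℤ × ℤ × ℕ

lhsL : Congruence → ℤ
lhsL (L Data.Product., _) = L

rhsM : Congruence → ℤ
rhsM (_ Data.Product., M Data.Product., _) = M

modN : Congruence → ℕ
modN (_ Data.Product., _ Data.Product., N) = N

Satisfies : ℕ → Congruence → ℕ → Set
Satisfies Q c e = ℤ.+ (modN c) ℤD.∣ (lhsL c ℤ.* ((ℤ.+ Q) ℤ.^ e) ℤ.- rhsM c)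

module Submission where

-- Write N = N′ · P^a with a = ord_P N and P ∤ N′.  Once N ≤ Q^e we have P^a ∣ Q^e, so modulo P^a
-- the congruence L Q^e ≡ M just says P^a ∣ M: in case (a) this fails, which bounds Q^e by N, and in
-- case (b) it always holds.  Modulo N′, Euler's theorem gives Q^φ(N) ≡ 1, so there the congruence
-- is f-periodic in e.  Hence in case (b) a solution e with Q^e ≥ Q^f · max 𝒩 can be lowered to
-- e − f, and the solutions below that bound are the starting points of the progressions.

open import Data.Integer as ℤ using (ℤ; +_; -_; ∣_∣; _%ℕ_; _/ℕ_)
import Data.Integer
import Data.Integer.Properties as ℤ
open import Data.Integer.DivMod using (a≡a%ℕn+[a/ℕn]*n)
open import Data.Integer.Divisibility.Signed as ℤ∣ using (_∣_; divides)
open import Data.Integer.Tactic.RingSolver using (solve-∀)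
open import Data.List using (List; []; _∷_; map; filter; length; upTo)
open import Data.List.Membership.Propositional using (_∈_; find; lose)
open import Data.List.Membership.Propositional.Properties
  using (∈-filter⁺; ∈-filter⁻; ∈-map⁺; ∈-map⁻; ∈-upTo⁺; ∈-upTo⁻)
open import Data.List.Membership.Propositional.Properties.WithK using (unique∧set⇒bag)
open import Data.List.Properties using (map-∘; map-id-local)
open import Data.List.Relation.Binary.BagAndSetEquality using (∼bag⇒↭)
open import Data.List.Relation.Binary.Permutation.Propositional using (_↭_)
open import Data.List.Relation.Unary.All as All using (All; []; _∷_)
import Data.List.Relation.Unary.All.Properties as All
open import Data.List.Relation.Unary.Any as Any using (Any)
open import Data.List.Relation.Unary.Unique.Propositional using (Unique)
import Data.List.Relation.Unary.Unique.Propositional.Properties as Unique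
open import Data.Nat as ℕ
  using (ℕ; zero; suc; 2+; _+_; _∸_; _*_; _^_; _≤_; _<_; z≤n; s≤s; NonZero; NonTrivial; _≟_)
import Data.Nat.Properties as ℕ
open import Data.Nat.Coprimality as Coprime using (Coprime)
open import Data.Nat.DivMod using (_%_; _/_; m%n<n; m<n⇒m%n≡m; m*[n/m]≡n; m/n<m; m≥n⇒m/n>0)
open import Data.Nat.Divisibility as ℕ∣ using (n∣m⇒m%n≡0; _∣?_)
open import Data.Nat.GCD using (gcd; gcd-zeroˡ; module Bézout)
open import Data.Nat.Induction using (<-wellFounded)
open import Data.Nat.ListAction using (product)
open import Data.Nat.ListAction.Properties using (product-↭; product≢0; ∈⇒∣product)
open import Data.Nat.Primality using (Prime; prime⇒irreducible; prime⇒nonTrivial)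
open import Data.Product using (∃; _×_; _,_; proj₁; proj₂)
open import Data.Sum using (inj₁; inj₂)
open import Function.Base using (_∘_)
open import Function.Bundles using (_⇔_; mk⇔)
open import Induction.WellFounded using (Acc; acc)
open import Relation.Binary.Bundles using (Setoid)
open import Relation.Binary.PropositionalEquality
import Relation.Binary.Reasoning.Setoid as SetoidReasoning
open import Relation.Binary.Structures using (IsEquivalence)
open import Relation.Nullary using (¬_; contradiction; yes; no)
open import Relation.Nullary.Decidable using (Dec; _×-dec_)
open import Relation.Unary using (Decidable)

open import Defs

-- Congruences of integers

infix 4 _≡_mod_

record _≡_mod_ (a b d : ℤ) : Set where
  constructor ∣⇒≡-mod
  field ≡-mod⇒∣ : d ∣ a ℤ.- b

open _≡_mod_ public

module _ {d : ℤ} where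

  ≡⇒≡-mod : ∀ {a b} → a ≡ b → a ≡ b mod d
  ≡⇒≡-mod {a} refl = ∣⇒≡-mod (divides (+ 0) (ℤ.+-inverseʳ a))

  ≡-mod-sym : ∀ {a b} → a ≡ b mod d → b ≡ a mod d
  ≡-mod-sym {a} {b} (∣⇒≡-mod d∣a-b) = ∣⇒≡-mod (subst (d ∣_) (negate a b) (ℤ∣.∣m⇒∣-m d∣a-b))
    where
    negate : ∀ a b → - (a ℤ.- b) ≡ b ℤ.- a
    negate = solve-∀

  ≡-mod-trans : ∀ {a b c} → a ≡ b mod d → b ≡ c mod d → a ≡ c mod d
  ≡-mod-trans {a} {b} {c} (∣⇒≡-mod d∣a-b) (∣⇒≡-mod d∣b-c) =
    ∣⇒≡-mod (subst (d ∣_) (telescope a b c) (ℤ∣.∣m∣n⇒∣m+n d∣a-b d∣b-c))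
    where
    telescope : ∀ a b c → (a ℤ.- b) ℤ.+ (b ℤ.- c) ≡ a ℤ.- c
    telescope = solve-∀

  ≡-mod-isEquivalence : IsEquivalence (λ a b → a ≡ b mod d)
  ≡-mod-isEquivalence = record { refl = ≡⇒≡-mod refl ; sym = ≡-mod-sym ; trans = ≡-mod-trans }

  ≡-mod-*-cong : ∀ {a b x y} → a ≡ b mod d → x ≡ y mod d → a ℤ.* x ≡ b ℤ.* y mod d
  ≡-mod-*-cong {a} {b} {x} {y} (∣⇒≡-mod d∣a-b) (∣⇒≡-mod d∣x-y) =
    ∣⇒≡-mod (subst (d ∣_) (split a b x y) (ℤ∣.∣m∣n⇒∣m+n (ℤ∣.∣n⇒∣m*n a d∣x-y) (ℤ∣.∣n⇒∣m*n y d∣a-b)))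
    where
    split : ∀ a b x y → a ℤ.* (x ℤ.- y) ℤ.+ y ℤ.* (a ℤ.- b) ≡ a ℤ.* x ℤ.- b ℤ.* y
    split = solve-∀

  ≡-mod-*-congˡ : ∀ a {x y} → x ≡ y mod d → a ℤ.* x ≡ a ℤ.* y mod d
  ≡-mod-*-congˡ a = ≡-mod-*-cong (≡⇒≡-mod {a = a} refl)

  ≡-mod-*-congʳ : ∀ c {a b} → a ≡ b mod d → a ℤ.* c ≡ b ℤ.* c mod d
  ≡-mod-*-congʳ c a≡b = ≡-mod-*-cong a≡b (≡⇒≡-mod {a = c} refl)

  ≡-mod-^-cong : ∀ {a b} n → a ≡ b mod d → a ℤ.^ n ≡ b ℤ.^ n mod d
  ≡-mod-^-cong zero    a≡b = ≡⇒≡-mod refl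
  ≡-mod-^-cong (suc n) a≡b = ≡-mod-*-cong a≡b (≡-mod-^-cong n a≡b)

  ∣⇒≡0-mod : ∀ {a} → d ∣ a → a ≡ + 0 mod d
  ∣⇒≡0-mod {a} d∣a = ∣⇒≡-mod (subst (d ∣_) (sym (ℤ.+-identityʳ a)) d∣a)

  ≡0-mod⇒∣ : ∀ {a} → a ≡ + 0 mod d → d ∣ a
  ≡0-mod⇒∣ {a} (∣⇒≡-mod d∣a-0) = subst (d ∣_) (ℤ.+-identityʳ a) d∣a-0

  +-multiple-≡-mod : ∀ a k → a ℤ.+ k ℤ.* d ≡ a mod d
  +-multiple-≡-mod a k = ∣⇒≡-mod (divides k (cancel a k d))
    where
    cancel : ∀ a k d → a ℤ.+ k ℤ.* d ℤ.- a ≡ k ℤ.* d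
    cancel = solve-∀

≡-mod-setoid : ℤ → Setoid _ _
≡-mod-setoid d = record { isEquivalence = ≡-mod-isEquivalence {d} }

module ≡-mod-Reasoning (d : ℤ) = SetoidReasoning (≡-mod-setoid d)

≡-mod-weaken : ∀ {d n a b} → d ∣ n → a ≡ b mod n → a ≡ b mod d
≡-mod-weaken d∣n (∣⇒≡-mod n∣a-b) = ∣⇒≡-mod (ℤ∣.∣-trans d∣n n∣a-b)

%ℕ-≡-mod : ∀ i n .{{_ : NonZero n}} → + (i %ℕ n) ≡ i mod + n
%ℕ-≡-mod i n =
  ≡-mod-sym (≡-mod-trans (≡⇒≡-mod (a≡a%ℕn+[a/ℕn]*n i n)) (+-multiple-≡-mod (+ (i %ℕ n)) (i /ℕ n)))

≡-mod⇒≡ : ∀ {n u v} → u < n → v < n → + u ≡ + v mod + n → u ≡ v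
≡-mod⇒≡ {n} {u} {v} u<n v<n (∣⇒≡-mod n∣u-v) =
  ℤ.+-injective (ℤ.i-j≡0⇒i≡j (+ u) (+ v) (ℤ.∣i∣≡0⇒i≡0 ∣u-v∣≡0))
  where
  instance
    n≢0 : NonZero n
    n≢0 = ℕ.>-nonZero (ℕ.≤-<-trans z≤n u<n)
  ∣u-v∣<n : ∣ + u ℤ.- + v ∣ < n
  ∣u-v∣<n = ℕ.≤-<-trans (subst (ℕ._≤ u ℕ.⊔ v) (cong ∣_∣ (sym (ℤ.m-n≡m⊖n u v))) (ℤ.∣m⊝n∣≤m⊔n u v))
                        (ℕ.⊔-lub u<n v<n)
  ∣u-v∣≡0 : ∣ + u ℤ.- + v ∣ ≡ 0
  ∣u-v∣≡0 = trans (sym (m<n⇒m%n≡m ∣u-v∣<n)) (n∣m⇒m%n≡0 _ n (ℤ∣.∣⇒∣ᵤ n∣u-v))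

≡-mod-cancelˡ : ∀ {m n a b} → Coprime n m → + m ℤ.* a ≡ + m ℤ.* b mod + n → a ≡ b mod + n
≡-mod-cancelˡ {m} {n} {a} {b} n⊥m (∣⇒≡-mod n∣ma-mb) =
  ∣⇒≡-mod (ℤ∣.∣ᵤ⇒∣ (Coprime.coprime-divisor n⊥m n∣m∣a-b∣))
  where
  factor : ∀ m a b → m ℤ.* a ℤ.- m ℤ.* b ≡ m ℤ.* (a ℤ.- b)
  factor = solve-∀
  n∣m∣a-b∣ : n ℕ∣.∣ m * ∣ a ℤ.- b ∣
  n∣m∣a-b∣ = subst (n ℕ∣.∣_) (trans (cong ∣_∣ (factor (+ m) a b)) (ℤ.abs-* (+ m) (a ℤ.- b)))
                   (ℤ∣.∣⇒∣ᵤ n∣ma-mb)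

coprime-∣⇒*∣ : ∀ {m n x} → Coprime m n → m ℕ∣.∣ x → n ℕ∣.∣ x → m * n ℕ∣.∣ x
coprime-∣⇒*∣ {m} {n} m⊥n m∣x (ℕ∣.divides q refl) =
  ℕ∣.*-monoˡ-∣ n (Coprime.coprime-divisor m⊥n (subst (m ℕ∣.∣_) (ℕ.*-comm q n) m∣x))

≡-mod-chinese : ∀ {m n a b} → Coprime m n → a ≡ b mod + m → a ≡ b mod + n → a ≡ b mod + (m * n)
≡-mod-chinese m⊥n (∣⇒≡-mod m∣a-b) (∣⇒≡-mod n∣a-b) =
  ∣⇒≡-mod (ℤ∣.∣ᵤ⇒∣ (coprime-∣⇒*∣ m⊥n (ℤ∣.∣⇒∣ᵤ m∣a-b) (ℤ∣.∣⇒∣ᵤ n∣a-b)))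

pos-^ : ∀ m n → + (m ^ n) ≡ (+ m) ℤ.^ n
pos-^ m zero    = refl
pos-^ m (suc n) = trans (ℤ.pos-* m (m ^ n)) (cong (+ m ℤ.*_) (pos-^ m n))

coprime-* : ∀ {a b n} → Coprime a n → Coprime b n → Coprime (a * b) n
coprime-* {a} {b} {n} a⊥n b⊥n {d} (d∣ab , d∣n) = b⊥n (Coprime.coprime-divisor d⊥a d∣ab , d∣n)
  where
  d⊥a : Coprime d a
  d⊥a (e∣d , e∣a) = a⊥n (e∣a , ℕ∣.∣-trans e∣d d∣n)

coprime-^ : ∀ {a n} j → Coprime a n → Coprime (a ^ j) n
coprime-^ {n = n} zero    _   = Coprime.1-coprimeTo n
coprime-^         (suc j) a⊥n = coprime-* a⊥n (coprime-^ j a⊥n)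

coprime-product : ∀ {n} us → All (λ u → Coprime u n) us → Coprime (product us) n
coprime-product {n} []       []           = Coprime.1-coprimeTo n
coprime-product     (u ∷ us) (u⊥n ∷ us⊥n) = coprime-* u⊥n (coprime-product us us⊥n)

coprime-% : ∀ {a n} .{{_ : NonZero n}} → Coprime a n → Coprime (a % n) n
coprime-% a⊥n (d∣a%n , d∣n) = a⊥n (ℕ∣.∣n∣m%n⇒∣m d∣n d∣a%n , d∣n)

coprime-+-∣ : ∀ {m n o} → Coprime m n → n ℕ∣.∣ o → Coprime (m + o) n
coprime-+-∣ {m} {n} {o} m⊥n n∣o {d} (d∣m+o , d∣n) =
  m⊥n (ℕ∣.∣m+n∣m⇒∣n (subst (d ℕ∣.∣_) (ℕ.+-comm m o) d∣m+o) (ℕ∣.∣-trans d∣n n∣o) , d∣n)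

prime∤⇒coprime : ∀ {p n} → Prime p → ¬ p ℕ∣.∣ n → Coprime p n
prime∤⇒coprime p-prime p∤n (d∣p , d∣n) with prime⇒irreducible p-prime d∣p
... | inj₁ d≡1  = d≡1
... | inj₂ refl = contradiction d∣n p∤n

inverse⇒coprime : ∀ a b {n} → + a ℤ.* + b ≡ + 1 mod + n → Coprime a n
inverse⇒coprime a b {n} (∣⇒≡-mod n∣ab-1) {d} (d∣a , d∣n) = ℕ∣.∣1⇒≡1 (ℤ∣.∣⇒∣ᵤ d∣1)
  where
  cancel : ∀ x → x ℤ.- (x ℤ.- + 1) ≡ + 1
  cancel = solve-∀
  d∣ab : + d ∣ + a ℤ.* + b
  d∣ab = ℤ∣.∣m⇒∣m*n (+ b) (ℤ∣.∣ᵤ⇒∣ {+ d} {+ a} d∣a)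
  d∣1 : + d ∣ + 1
  d∣1 = subst (+ d ∣_) (cancel (+ a ℤ.* + b)) (ℤ∣.∣m∣n⇒∣m-n d∣ab (ℤ∣.∣-trans (ℤ∣.∣ᵤ⇒∣ d∣n) n∣ab-1))

coprime⇒inverse : ∀ {c n} → Coprime c n → ∃ λ i → i ℤ.* + c ≡ + 1 mod + n
coprime⇒inverse {c} {n} c⊥n with Coprime.coprime-Bézout c⊥n
... | Bézout.+- x y 1+yn≡xc = + x , (begin
  + x ℤ.* + c           ≡⟨ ℤ.pos-* x c ⟨
  + (x * c)             ≡⟨ cong +_ 1+yn≡xc ⟨
  + (1 + y * n)         ≡⟨ trans (ℤ.pos-+ 1 (y * n)) (cong (λ z → + 1 ℤ.+ z) (ℤ.pos-* y n)) ⟩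
  + 1 ℤ.+ + y ℤ.* + n   ≈⟨ +-multiple-≡-mod (+ 1) (+ y) ⟩
  + 1                   ∎)
  where open ≡-mod-Reasoning (+ n)
... | Bézout.-+ x y 1+xc≡yn = - + x , (begin
  - + x ℤ.* + c                  ≡⟨ negate (+ x) (+ c) ⟩
  + 1 ℤ.- (+ 1 ℤ.+ + x ℤ.* + c)  ≡⟨ cong (λ z → + 1 ℤ.- z) 1+xc≡yn′ ⟩
  + 1 ℤ.- + y ℤ.* + n            ≡⟨ cong (λ z → + 1 ℤ.+ z) (ℤ.neg-distribˡ-* (+ y) (+ n)) ⟩
  + 1 ℤ.+ - + y ℤ.* + n          ≈⟨ +-multiple-≡-mod (+ 1) (- + y) ⟩
  + 1                            ∎)
  where
  open ≡-mod-Reasoning (+ n)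
  negate : ∀ x c → - x ℤ.* c ≡ + 1 ℤ.- (+ 1 ℤ.+ x ℤ.* c)
  negate = solve-∀
  1+xc≡yn′ : + 1 ℤ.+ + x ℤ.* + c ≡ + y ℤ.* + n
  1+xc≡yn′ = trans (cong (λ z → + 1 ℤ.+ z) (sym (ℤ.pos-* x c))) (trans (cong +_ 1+xc≡yn) (ℤ.pos-* y n))

-- Euler's theorem

-- φ n is definitionally length (totatives n).
totatives : ℕ → List ℕ
totatives n = filter (λ k → gcd k n ≟ 1) (map suc (upTo n))

module _ {n : ℕ} .{{_ : NonTrivial n}} where

  private instance
    n≢0 : NonZero n
    n≢0 = ℕ.nonTrivial⇒nonZero n

  ∈-totatives⁻ : ∀ {x} → x ∈ totatives n → x < n × Coprime x n
  ∈-totatives⁻ x∈ with ∈-filter⁻ (λ k → gcd k n ≟ 1) {xs = map suc (upTo n)} x∈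
  ... | x∈[1,n] , gcd≡1 with ∈-map⁻ suc x∈[1,n]
  ... | i , i∈upTo , refl = ℕ.≤∧≢⇒< (∈-upTo⁻ i∈upTo) 1+i≢n , 1+i⊥n
    where
    1+i⊥n : Coprime (suc i) n
    1+i⊥n = Coprime.gcd≡1⇒coprime gcd≡1
    1+i≢n : suc i ≢ n
    1+i≢n refl = ℕ.nonTrivial⇒≢1 (1+i⊥n (ℕ∣.∣-refl , ℕ∣.∣-refl))

  ∈-totatives⁺ : ∀ {x} → x < n → Coprime x n → x ∈ totatives n
  ∈-totatives⁺ {zero}  _   0⊥n = contradiction (λ {d} → 0⊥n {d}) Coprime.¬0-coprimeTo-2+
  ∈-totatives⁺ {suc i} x<n x⊥n = ∈-filter⁺ (λ k → gcd k n ≟ 1)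
    (∈-map⁺ suc (∈-upTo⁺ (ℕ.<-trans (ℕ.n<1+n i) x<n))) (Coprime.coprime⇒gcd≡1 x⊥n)

  totatives-unique : Unique (totatives n)
  totatives-unique =
    Unique.filter⁺ (λ k → gcd k n ≟ 1) (Unique.map⁺ ℕ.suc-injective (Unique.upTo⁺ n))

  mulMod : ℕ → ℕ → ℕ
  mulMod c u = (c * u) % n

  mulMod-≡-mod : ∀ c u → + mulMod c u ≡ + c ℤ.* + u mod + n
  mulMod-≡-mod c u = ≡-mod-trans (%ℕ-≡-mod (+ (c * u)) n) (≡⇒≡-mod (ℤ.pos-* c u))

  mulMod-∈ : ∀ {c u} → Coprime c n → u ∈ totatives n → mulMod c u ∈ totatives n
  mulMod-∈ {c} {u} c⊥n u∈ =
    ∈-totatives⁺ (m%n<n (c * u) n) (coprime-% (coprime-* c⊥n (proj₂ (∈-totatives⁻ u∈))))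

  mulMod-inverse : ∀ a b {u} → + a ℤ.* + b ≡ + 1 mod + n → u < n → mulMod a (mulMod b u) ≡ u
  mulMod-inverse a b {u} ab≡1 u<n = ≡-mod⇒≡ (m%n<n (a * mulMod b u) n) u<n (begin
    + mulMod a (mulMod b u)  ≈⟨ mulMod-≡-mod a (mulMod b u) ⟩
    + a ℤ.* + mulMod b u     ≈⟨ ≡-mod-*-congˡ (+ a) (mulMod-≡-mod b u) ⟩
    + a ℤ.* (+ b ℤ.* + u)    ≡⟨ ℤ.*-assoc (+ a) (+ b) (+ u) ⟨
    (+ a ℤ.* + b) ℤ.* + u    ≈⟨ ≡-mod-*-congʳ (+ u) ab≡1 ⟩
    + 1 ℤ.* + u              ≡⟨ ℤ.*-identityˡ (+ u) ⟩
    + u                      ∎)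
    where open ≡-mod-Reasoning (+ n)

  -- Multiplication by an inverse c′ of c undoes mulMod c on the totatives, from either side.
  mulMod-↭ : ∀ {c} → Coprime c n → map (mulMod c) (totatives n) ↭ totatives n
  mulMod-↭ {c} c⊥n with coprime⇒inverse c⊥n
  ... | i , ic≡1 = ∼bag⇒↭ (unique∧set⇒bag image-unique totatives-unique (mk⇔ image⊆ ⊆image))
    where
    T : List ℕ
    T = totatives n
    c′ : ℕ
    c′ = i %ℕ n
    c′c≡1 : + c′ ℤ.* + c ≡ + 1 mod + n
    c′c≡1 = ≡-mod-trans (≡-mod-*-congʳ (+ c) (%ℕ-≡-mod i n)) ic≡1
    cc′≡1 : + c ℤ.* + c′ ≡ + 1 mod + n
    cc′≡1 = ≡-mod-trans (≡⇒≡-mod (ℤ.*-comm (+ c) (+ c′))) c′c≡1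
    undo : map (mulMod c′) (map (mulMod c) T) ≡ T
    undo = trans (sym (map-∘ {g = mulMod c′} {f = mulMod c} T))
      (map-id-local (All.tabulate (λ u∈ → mulMod-inverse c′ c c′c≡1 (proj₁ (∈-totatives⁻ u∈)))))
    image-unique : Unique (map (mulMod c) T)
    image-unique = Unique.map⁻ (subst Unique (sym undo) totatives-unique)
    image⊆ : ∀ {x} → x ∈ map (mulMod c) T → x ∈ T
    image⊆ x∈ with ∈-map⁻ (mulMod c) x∈
    ... | u , u∈ , refl = mulMod-∈ c⊥n u∈
    ⊆image : ∀ {x} → x ∈ T → x ∈ map (mulMod c) T
    ⊆image x∈ = subst (_∈ map (mulMod c) T) (mulMod-inverse c c′ cc′≡1 (proj₁ (∈-totatives⁻ x∈)))
      (∈-map⁺ (mulMod c) (mulMod-∈ (inverse⇒coprime c′ c c′c≡1) x∈))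

  product-map-mulMod : ∀ c us →
    + product (map (mulMod c) us) ≡ (+ c) ℤ.^ length us ℤ.* + product us mod + n
  product-map-mulMod c []       = ≡⇒≡-mod refl
  product-map-mulMod c (u ∷ us) = begin
    + (mulMod c u * product (map (mulMod c) us))               ≡⟨ ℤ.pos-* (mulMod c u) _ ⟩
    + mulMod c u ℤ.* + product (map (mulMod c) us)             ≈⟨ ≡-mod-*-cong (mulMod-≡-mod c u)
                                                                                (product-map-mulMod c us) ⟩
    (+ c ℤ.* + u) ℤ.* ((+ c) ℤ.^ length us ℤ.* + product us)   ≡⟨ shuffle (+ c) (+ u) _ _ ⟩
    (+ c ℤ.* (+ c) ℤ.^ length us) ℤ.* (+ u ℤ.* + product us)   ≡⟨ cong (ℤ._*_ (+ c ℤ.* (+ c) ℤ.^ length us))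
                                                                       (ℤ.pos-* u (product us)) ⟨
    (+ c) ℤ.^ length (u ∷ us) ℤ.* + product (u ∷ us)           ∎
    where
    open ≡-mod-Reasoning (+ n)
    shuffle : ∀ c u cˡ p → (c ℤ.* u) ℤ.* (cˡ ℤ.* p) ≡ (c ℤ.* cˡ) ℤ.* (u ℤ.* p)
    shuffle = solve-∀

  euler-nonTrivial : ∀ {c} → Coprime c n → (+ c) ℤ.^ φ n ≡ + 1 mod + n
  euler-nonTrivial {c} c⊥n = ≡-mod-cancelˡ (Coprime.sym Π⊥n) (begin
    + Π ℤ.* (+ c) ℤ.^ φ n              ≡⟨ ℤ.*-comm (+ Π) _ ⟩
    (+ c) ℤ.^ φ n ℤ.* + Π              ≈⟨ product-map-mulMod c T ⟨
    + product (map (mulMod c) T)       ≡⟨ cong +_ (product-↭ (mulMod-↭ c⊥n)) ⟩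
    + Π                                ≡⟨ ℤ.*-identityʳ (+ Π) ⟨
    + Π ℤ.* + 1                        ∎)
    where
    open ≡-mod-Reasoning (+ n)
    T : List ℕ
    T = totatives n
    Π : ℕ
    Π = product T
    Π⊥n : Coprime Π n
    Π⊥n = coprime-product T (All.tabulate (λ u∈ → proj₂ (∈-totatives⁻ u∈)))

euler : ∀ {c} n .{{_ : NonZero n}} → Coprime c n → (+ c) ℤ.^ φ n ≡ + 1 mod + n
euler 1      _ = ∣⇒≡-mod (ℤ∣.∣ᵤ⇒∣ (ℕ∣.1∣ _))
euler (2+ _)   = euler-nonTrivial

0<φ : ∀ {n} → 0 < n → 0 < φ n
0<φ {n} 0<n = nonempty (∈-filter⁺ (λ k → gcd k n ≟ 1) (∈-map⁺ suc (∈-upTo⁺ 0<n)) (gcd-zeroˡ n))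
  where
  nonempty : ∀ {x : ℕ} {xs} → x ∈ xs → 0 < length xs
  nonempty (Any.here _)  = s≤s z≤n
  nonempty (Any.there _) = s≤s z≤n

-- Exact prime powers

infix 4 _^_∥_

_^_∥_ : ℕ → ℕ → ℕ → Set
p ^ a ∥ n = p ^ a ℕ∣.∣ n × ¬ p ^ suc a ℕ∣.∣ n

^∥-*ˡ : ∀ p a {r} .{{_ : NonZero p}} → p ^ a ∥ r → p ^ suc a ∥ p * r
^∥-*ˡ p a (p^a∣r , p^1+a∤r) =
  ℕ∣.*-monoʳ-∣ p p^a∣r , λ p^2+a∣pr → p^1+a∤r (ℕ∣.*-cancelˡ-∣ p p^2+a∣pr)

ordF-∥ : ∀ fuel q n → 0 < n → n ≤ fuel → 2+ q ^ ordF fuel (2+ q) n ∥ n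
ordF-∥ (suc fuel) q (suc m) _ (s≤s m≤fuel) with 2+ q ∣? suc m
... | no  p∤n = ℕ∣.1∣ _ , λ p^1∣n → p∤n (subst (ℕ∣._∣ suc m) (ℕ.*-identityʳ (2+ q)) p^1∣n)
... | yes p∣n = subst (2+ q ^ suc a ∥_) (m*[n/m]≡n p∣n) (^∥-*ˡ (2+ q) a (ordF-∥ fuel q r 0<r r≤fuel))
  where
  r : ℕ
  r = suc m / 2+ q
  a : ℕ
  a = ordF fuel (2+ q) r
  0<r : 0 < r
  0<r = m≥n⇒m/n>0 (ℕ∣.∣⇒≤ p∣n)
  r≤fuel : r ≤ fuel
  r≤fuel = ℕ.≤-trans (ℕ.≤-pred (m/n<m (suc m) (2+ q) (s≤s (s≤s z≤n)))) m≤fuel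

ord-∥ : ∀ p .{{_ : NonTrivial p}} {n} → 0 < n → p ^ ord p n ∥ n
ord-∥ (2+ q) {n} 0<n = ordF-∥ n q n 0<n ℕ.≤-refl

^-monoʳ-∣ : ∀ p {a b} → a ≤ b → p ^ a ℕ∣.∣ p ^ b
^-monoʳ-∣ p {a} {b} a≤b = ℕ∣.divides (p ^ (b ∸ a)) (begin
  p ^ b                ≡⟨ cong (p ^_) (ℕ.m+[n∸m]≡n a≤b) ⟨
  p ^ (a + (b ∸ a))    ≡⟨ ℕ.^-distribˡ-+-* p a (b ∸ a) ⟩
  p ^ a * p ^ (b ∸ a)  ≡⟨ ℕ.*-comm (p ^ a) _ ⟩
  p ^ (b ∸ a) * p ^ a  ∎)
  where open ≡-Reasoning

^-cancelʳ-≤ : ∀ p a b → 1 < p → p ^ a ≤ p ^ b → a ≤ b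
^-cancelʳ-≤ p a b 1<p p^a≤p^b = ℕ.≮⇒≥ λ b<a → ℕ.<⇒≱ (ℕ.^-monoʳ-< p 1<p b<a) p^a≤p^b

^∣⇒≤ord : ∀ p .{{_ : NonTrivial p}} {a n} → 0 < n → p ^ a ℕ∣.∣ n → a ≤ ord p n
^∣⇒≤ord p 0<n p^a∣n =
  ℕ.≮⇒≥ λ ord<a → proj₂ (ord-∥ p 0<n) (ℕ∣.∣-trans (^-monoʳ-∣ p ord<a) p^a∣n)

∣^-nonTrivial : ∀ p k → 1 < p ^ k → p ℕ∣.∣ p ^ k
∣^-nonTrivial p zero    1<1 = contradiction 1<1 (ℕ.<-irrefl refl)
∣^-nonTrivial p (suc k) _   = ℕ∣.m∣m*n (p ^ k)

n<m^n : ∀ m → 1 < m → ∀ n → n < m ^ n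
n<m^n m 1<m zero    = s≤s z≤n
n<m^n m 1<m (suc n) = ℕ.≤-<-trans (n<m^n m 1<m n) (ℕ.^-monoʳ-< m 1<m (ℕ.n<1+n n))

bounded⇒finite : ∀ {S : ℕ → Set} → Decidable S → ∀ n → (∀ e → S e → e ≤ n) →
                 ∃ λ (xs : List ℕ) → ∀ e → (S e ⇔ e ∈ xs)
bounded⇒finite {S} S? n bounded = filter S? (upTo (suc n)) , λ e → mk⇔
  (λ Se → ∈-filter⁺ S? (∈-upTo⁺ (s≤s (bounded e Se))) Se)
  (λ e∈ → proj₂ (∈-filter⁻ S? {xs = upTo (suc n)} e∈))

ultimately-periodic⇒progressions :
  ∀ {S : ℕ → Set} → Decidable S → ∀ {Q f B} → 1 < Q → 0 < f → 0 < B →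
  (∀ e → S e → S (e + f)) → (∀ d → B ≤ Q ^ d → S (d + f) → S d) →
  ∃ λ (E : List ℕ) → All (λ e₀ → Q ^ e₀ < Q ^ f * B) E ×
                     (∀ e → (S e ⇔ Any (λ e₀ → ∃ λ t → e ≡ e₀ + t * f) E))
ultimately-periodic⇒progressions {S} S? {Q} {f} {B} 1<Q 0<f 0<B shift-up shift-down =
  E , All.tabulate (λ e₀∈ → proj₂ (proj₂ (∈-filter⁻ initial? {xs = upTo bound} e₀∈))) ,
  λ e → mk⇔ (descend e (<-wellFounded e)) (ascend e)
  where
  bound : ℕ
  bound = Q ^ f * B
  initial? : ∀ e → Dec (S e × Q ^ e < bound)
  initial? e = S? e ×-dec (Q ^ e ℕ.<? bound)
  E : List ℕ
  E = filter initial? (upTo bound)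
  InProgression : ℕ → ℕ → Set
  InProgression e e₀ = ∃ λ t → e ≡ e₀ + t * f

  +-step : ∀ e₀ t → e₀ + t * f + f ≡ e₀ + suc t * f
  +-step e₀ t = trans (ℕ.+-assoc e₀ (t * f) f) (cong (λ z → e₀ + z) (ℕ.+-comm (t * f) f))

  iterate : ∀ e₀ t → S e₀ → S (e₀ + t * f)
  iterate e₀ zero    Se₀ = subst S (sym (ℕ.+-identityʳ e₀)) Se₀
  iterate e₀ (suc t) Se₀ = subst S (+-step e₀ t) (shift-up _ (iterate e₀ t Se₀))

  ascend : ∀ e → Any (InProgression e) E → S e
  ascend e e∈ with find e∈
  ... | e₀ , e₀∈E , t , refl = iterate e₀ t (proj₁ (proj₂ (∈-filter⁻ initial? {xs = upTo bound} e₀∈E)))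

  descend : ∀ e → Acc _<_ e → S e → Any (InProgression e) E
  descend e (acc below) Se with Q ^ e ℕ.<? bound
  ... | yes small = lose (∈-filter⁺ initial? (∈-upTo⁺ (ℕ.<-trans (n<m^n Q 1<Q e) small)) (Se , small))
                         (0 , sym (ℕ.+-identityʳ e))
  ... | no  large = Any.map
    (λ (t , d≡e₀+tf) → suc t , trans (sym d+f≡e) (trans (cong (_+ f) d≡e₀+tf) (+-step _ t)))
    (descend d (below d<e) Sd)
    where
    instance
      Q^f≢0 : NonZero (Q ^ f)
      Q^f≢0 = ℕ.m^n≢0 Q f {{ℕ.>-nonZero (ℕ.<-trans (s≤s z≤n) 1<Q)}}
      B≢0 : NonZero B
      B≢0 = ℕ.>-nonZero 0<B
    bound≤Q^e : bound ≤ Q ^ e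
    bound≤Q^e = ℕ.≮⇒≥ large
    f≤e : f ≤ e
    f≤e = ^-cancelʳ-≤ Q f e 1<Q (ℕ.≤-trans (ℕ.m≤m*n (Q ^ f) B) bound≤Q^e)
    d : ℕ
    d = e ∸ f
    d+f≡e : d + f ≡ e
    d+f≡e = ℕ.m∸n+n≡m f≤e
    d<e : d < e
    d<e = ℕ.∸-monoʳ-< 0<f f≤e
    B≤Q^d : B ≤ Q ^ d
    B≤Q^d = ℕ.*-cancelˡ-≤ (Q ^ f) (begin
      Q ^ f * B      ≤⟨ bound≤Q^e ⟩
      Q ^ e          ≡⟨ cong (Q ^_) d+f≡e ⟨
      Q ^ (d + f)    ≡⟨ ℕ.^-distribˡ-+-* Q d f ⟩
      Q ^ d * Q ^ f  ≡⟨ ℕ.*-comm (Q ^ d) (Q ^ f) ⟩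
      Q ^ f * Q ^ d  ∎)
      where open ℕ.≤-Reasoning
    Sd : S d
    Sd = shift-down d B≤Q^d (subst S (sym d+f≡e) Se)

∈⇒≤maxList : ∀ {n ns} → n ∈ ns → n ≤ maxList ns
∈⇒≤maxList {ns = m ∷ ns} (Any.here refl) = ℕ.m≤m⊔n m (maxList ns)
∈⇒≤maxList {ns = m ∷ ns} (Any.there n∈) = ℕ.≤-trans (∈⇒≤maxList n∈) (ℕ.m≤n⊔m m (maxList ns))

0<maxList : ∀ {ns} → All (0 <_) ns → ns ≢ [] → 0 < maxList ns
0<maxList []                ns≢[] = contradiction refl ns≢[]
0<maxList {m ∷ ns} (0<m ∷ _) _    = ℕ.<-≤-trans 0<m (ℕ.m≤m⊔n m (maxList ns))

0<prodList-φ : ∀ {ns} → All (0 <_) ns → 0 < prodList (map φ ns)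
0<prodList-φ pos =
  ℕ.>-nonZero⁻¹ _ {{product≢0 (All.map⁺ (All.map (λ 0<n → ℕ.>-nonZero (0<φ 0<n)) pos))}}

-- Congruences L Q^e ≡ M (mod N) with Q a power of the prime P

Bounding : ℕ → Congruence → Set
Bounding P c = (rhsM c ≢ + 0) × (ordℤ P (rhsM c) < ord P (modN c))

module PrimePower {P : ℕ} (P-prime : Prime P) {Q k : ℕ} (Q≡P^k : Q ≡ P ^ k) (1<Q : 1 < Q) where

  private instance
    P-nonTrivial : NonTrivial P
    P-nonTrivial = prime⇒nonTrivial P-prime

  Q^≡P^ : ∀ e → Q ^ e ≡ P ^ (k * e)
  Q^≡P^ e = trans (cong (_^ e) Q≡P^k) (ℕ.^-*-assoc P k e)

  P∣Q : P ℕ∣.∣ Q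
  P∣Q = subst (P ℕ∣.∣_) (sym Q≡P^k) (∣^-nonTrivial P k (subst (1 <_) Q≡P^k 1<Q))

  Q^≡0-mod-P^ord : ∀ {N} d → 0 < N → N ≤ Q ^ d → (+ Q) ℤ.^ d ≡ + 0 mod + (P ^ ord P N)
  Q^≡0-mod-P^ord {N} d 0<N N≤Q^d = ∣⇒≡0-mod (subst (_ ∣_) (pos-^ Q d) (ℤ∣.∣ᵤ⇒∣ P^ord∣Q^d))
    where
    ord≤kd : ord P N ≤ k * d
    ord≤kd = ^-cancelʳ-≤ P (ord P N) (k * d) (ℕ.nonTrivial⇒n>1 P) (begin
      P ^ ord P N  ≤⟨ ℕ∣.∣⇒≤ {{ℕ.>-nonZero 0<N}} (proj₁ (ord-∥ P 0<N)) ⟩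
      N            ≤⟨ N≤Q^d ⟩
      Q ^ d        ≡⟨ Q^≡P^ d ⟩
      P ^ (k * d)  ∎)
      where open ℕ.≤-Reasoning
    P^ord∣Q^d : P ^ ord P N ℕ∣.∣ Q ^ d
    P^ord∣Q^d = subst (P ^ ord P N ℕ∣.∣_) (sym (Q^≡P^ d)) (^-monoʳ-∣ P ord≤kd)

  solution-bounded : ∀ L e {M N} → 0 < N → M ≢ + 0 → ordℤ P M < ord P N →
                     L ℤ.* (+ Q) ℤ.^ e ≡ M mod + N → Q ^ e ≤ N
  solution-bounded L e {M} {N} 0<N M≢0 ordM<ordN LQ^e≡M = ℕ.≮⇒≥ λ N<Q^e →
    ℕ.<⇒≱ ordM<ordN (^∣⇒≤ord P 0<∣M∣ (ℤ∣.∣⇒∣ᵤ (≡0-mod⇒∣ (M≡0 N<Q^e))))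
    where
    0<∣M∣ : 0 < ∣ M ∣
    0<∣M∣ = ℕ.n≢0⇒n>0 (λ ∣M∣≡0 → M≢0 (ℤ.∣i∣≡0⇒i≡0 ∣M∣≡0))
    M≡0 : N < Q ^ e → M ≡ + 0 mod + (P ^ ord P N)
    M≡0 N<Q^e = begin
      M                  ≈⟨ ≡-mod-weaken (ℤ∣.∣ᵤ⇒∣ (proj₁ (ord-∥ P 0<N))) LQ^e≡M ⟨
      L ℤ.* (+ Q) ℤ.^ e  ≈⟨ ≡-mod-*-congˡ L (Q^≡0-mod-P^ord e 0<N (ℕ.<⇒≤ N<Q^e)) ⟩
      L ℤ.* + 0          ≡⟨ ℤ.*-zeroʳ L ⟩
      + 0                ∎
      where open ≡-mod-Reasoning (+ (P ^ ord P N))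

  LQ^[e+f]≡LQ^e*Q^f : ∀ L e f → L ℤ.* (+ Q) ℤ.^ (e + f) ≡ L ℤ.* (+ Q) ℤ.^ e ℤ.* (+ Q) ℤ.^ f
  LQ^[e+f]≡LQ^e*Q^f L e f = trans (cong (L ℤ.*_) (ℤ.^-distribˡ-+-* (+ Q) e f)) (sym (ℤ.*-assoc L _ _))

  module Cofactor {N : ℕ} (0<N : 0 < N) where

    a : ℕ
    a = ord P N

    N′ : ℕ
    N′ = ℕ∣.quotient (proj₁ (ord-∥ P 0<N))

    N≡N′*P^a : N ≡ N′ * P ^ a
    N≡N′*P^a = ℕ∣.m∣n⇒n≡quotient*m (proj₁ (ord-∥ P 0<N))

    P⊥N′ : Coprime P N′
    P⊥N′ = prime∤⇒coprime P-prime λ P∣N′ →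
      proj₂ (ord-∥ P 0<N) (subst (P ^ suc a ℕ∣.∣_) (sym N≡N′*P^a) (ℕ∣.*-monoˡ-∣ (P ^ a) P∣N′))

    ≡-mod-N⇒N′ : ∀ {x y} → x ≡ y mod + N → x ≡ y mod + N′
    ≡-mod-N⇒N′ = ≡-mod-weaken (ℤ∣.∣ᵤ⇒∣ (ℕ∣.divides (P ^ a) (trans N≡N′*P^a (ℕ.*-comm N′ (P ^ a)))))

    ≡-mod-N⇒P^a : ∀ {x y} → x ≡ y mod + N → x ≡ y mod + (P ^ a)
    ≡-mod-N⇒P^a = ≡-mod-weaken (ℤ∣.∣ᵤ⇒∣ (proj₁ (ord-∥ P 0<N)))

    ≡-mod-N′×P^a⇒N : ∀ {x y} → x ≡ y mod + N′ → x ≡ y mod + (P ^ a) → x ≡ y mod + N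
    ≡-mod-N′×P^a⇒N x≡y[N′] x≡y[P^a] = subst (λ n → _ ≡ _ mod + n) (sym N≡N′*P^a)
      (≡-mod-chinese (Coprime.sym (coprime-^ a P⊥N′)) x≡y[N′] x≡y[P^a])

    -- Q need not be coprime to N, but c = N′ + Q is, and c ≡ Q (mod N′); apply Euler's theorem to c.
    Q^φ≡1 : (+ Q) ℤ.^ φ N ≡ + 1 mod + N′
    Q^φ≡1 = begin
      (+ Q) ℤ.^ φ N  ≈⟨ ≡-mod-^-cong (φ N) c≡Q ⟨
      (+ c) ℤ.^ φ N  ≈⟨ ≡-mod-N⇒N′ (euler N {{ℕ.>-nonZero 0<N}} c⊥N) ⟩
      + 1            ∎
      where
      open ≡-mod-Reasoning (+ N′)
      cancel : ∀ n q → n ≡ n ℤ.+ q ℤ.- q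
      cancel = solve-∀
      c : ℕ
      c = N′ + Q
      c≡Q : + c ≡ + Q mod + N′
      c≡Q = ∣⇒≡-mod (subst (+ N′ ∣_) (trans (cancel (+ N′) (+ Q)) (cong (ℤ._- + Q) (sym (ℤ.pos-+ N′ Q))))
                          ℤ∣.∣-refl)
      c⊥N′ : Coprime c N′
      c⊥N′ = Coprime.coprime-+ (subst (λ q → Coprime q N′) (sym Q≡P^k) (coprime-^ k P⊥N′))
      c⊥P^a : Coprime c (P ^ a)
      c⊥P^a = Coprime.sym (coprime-^ a (Coprime.sym (coprime-+-∣ (Coprime.sym P⊥N′) P∣Q)))
      c⊥N : Coprime c N
      c⊥N = subst (Coprime c) (sym N≡N′*P^a)
                  (Coprime.sym (coprime-* (Coprime.sym c⊥N′) (Coprime.sym c⊥P^a)))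

    Q^f≡1 : ∀ {f} → φ N ℕ∣.∣ f → (+ Q) ℤ.^ f ≡ + 1 mod + N′
    Q^f≡1 (ℕ∣.divides j refl) = begin
      (+ Q) ℤ.^ (j * φ N)     ≡⟨ cong ((+ Q) ℤ.^_) (ℕ.*-comm j (φ N)) ⟩
      (+ Q) ℤ.^ (φ N * j)     ≡⟨ ℤ.^-*-assoc (+ Q) (φ N) j ⟨
      ((+ Q) ℤ.^ φ N) ℤ.^ j   ≈⟨ ≡-mod-^-cong j Q^φ≡1 ⟩
      (+ 1) ℤ.^ j             ≡⟨ ℤ.^-zeroˡ j ⟩
      + 1                     ∎
      where open ≡-mod-Reasoning (+ N′)

    LQ^[e+f]≡LQ^e : ∀ L e {f} → φ N ℕ∣.∣ f → L ℤ.* (+ Q) ℤ.^ (e + f) ≡ L ℤ.* (+ Q) ℤ.^ e mod + N′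
    LQ^[e+f]≡LQ^e L e {f} φ∣f = begin
      L ℤ.* (+ Q) ℤ.^ (e + f)            ≡⟨ LQ^[e+f]≡LQ^e*Q^f L e f ⟩
      L ℤ.* (+ Q) ℤ.^ e ℤ.* (+ Q) ℤ.^ f  ≈⟨ ≡-mod-*-congˡ (L ℤ.* (+ Q) ℤ.^ e) (Q^f≡1 φ∣f) ⟩
      L ℤ.* (+ Q) ℤ.^ e ℤ.* + 1          ≡⟨ ℤ.*-identityʳ _ ⟩
      L ℤ.* (+ Q) ℤ.^ e                  ∎
      where open ≡-mod-Reasoning (+ N′)

    shift-up : ∀ L e {M f} → + (P ^ a) ∣ M → φ N ℕ∣.∣ f →
               L ℤ.* (+ Q) ℤ.^ e ≡ M mod + N → L ℤ.* (+ Q) ℤ.^ (e + f) ≡ M mod + N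
    shift-up L e {M} {f} P^a∣M φ∣f LQ^e≡M = ≡-mod-N′×P^a⇒N
      (≡-mod-trans (LQ^[e+f]≡LQ^e L e φ∣f) (≡-mod-N⇒N′ LQ^e≡M))
      (begin
        L ℤ.* (+ Q) ℤ.^ (e + f)            ≡⟨ LQ^[e+f]≡LQ^e*Q^f L e f ⟩
        L ℤ.* (+ Q) ℤ.^ e ℤ.* (+ Q) ℤ.^ f  ≈⟨ ≡-mod-*-congʳ ((+ Q) ℤ.^ f) (≡-mod-N⇒P^a LQ^e≡M) ⟩
        M ℤ.* (+ Q) ℤ.^ f                  ≈⟨ ≡-mod-*-congʳ ((+ Q) ℤ.^ f) (∣⇒≡0-mod P^a∣M) ⟩
        + 0 ℤ.* (+ Q) ℤ.^ f                ≡⟨ ℤ.*-zeroˡ ((+ Q) ℤ.^ f) ⟩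
        + 0                                ≈⟨ ∣⇒≡0-mod P^a∣M ⟨
        M                                  ∎)
      where open ≡-mod-Reasoning (+ (P ^ a))

    shift-down : ∀ L d {M f} → + (P ^ a) ∣ M → φ N ℕ∣.∣ f → N ≤ Q ^ d →
                 L ℤ.* (+ Q) ℤ.^ (d + f) ≡ M mod + N → L ℤ.* (+ Q) ℤ.^ d ≡ M mod + N
    shift-down L d {M} {f} P^a∣M φ∣f N≤Q^d LQ^[d+f]≡M = ≡-mod-N′×P^a⇒N
      (≡-mod-trans (≡-mod-sym (LQ^[e+f]≡LQ^e L d φ∣f)) (≡-mod-N⇒N′ LQ^[d+f]≡M))
      (begin
        L ℤ.* (+ Q) ℤ.^ d  ≈⟨ ≡-mod-*-congˡ L (Q^≡0-mod-P^ord d 0<N N≤Q^d) ⟩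
        L ℤ.* + 0          ≡⟨ ℤ.*-zeroʳ L ⟩
        + 0                ≈⟨ ∣⇒≡0-mod P^a∣M ⟨
        M                  ∎)
      where open ≡-mod-Reasoning (+ (P ^ a))

  satisfies? : ∀ c e → Dec (Satisfies Q c e)
  satisfies? (L , M , N) e = N ∣? ∣ L ℤ.* (+ Q) ℤ.^ e ℤ.- M ∣

  satisfies⇒≡-mod : ∀ c e → Satisfies Q c e → lhsL c ℤ.* (+ Q) ℤ.^ e ≡ rhsM c mod + modN c
  satisfies⇒≡-mod (L , M , N) e sat = ∣⇒≡-mod (ℤ∣.∣ᵤ⇒∣ sat)

  ≡-mod⇒satisfies : ∀ c e → lhsL c ℤ.* (+ Q) ℤ.^ e ≡ rhsM c mod + modN c → Satisfies Q c e
  ≡-mod⇒satisfies (L , M , N) e LQ^e≡M = ℤ∣.∣⇒∣ᵤ (≡-mod⇒∣ LQ^e≡M)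

  ¬bounding⇒P^ord∣rhs : ∀ c → 0 < modN c → ¬ Bounding P c → + (P ^ ord P (modN c)) ∣ rhsM c
  ¬bounding⇒P^ord∣rhs (L , M , N) 0<N ¬bounding with M ℤ.≟ + 0
  ... | yes refl = ℤ∣.∣ᵤ⇒∣ {+ (P ^ ord P N)} {+ 0} (ℕ∣._∣0 _)
  ... | no  M≢0  = ℤ∣.∣ᵤ⇒∣ (ℕ∣.∣-trans (^-monoʳ-∣ P ordN≤ordM) (proj₁ (ord-∥ P 0<∣M∣)))
    where
    ordN≤ordM : ord P N ≤ ordℤ P M
    ordN≤ordM = ℕ.≮⇒≥ λ ordM<ordN → ¬bounding (M≢0 , ordM<ordN)
    0<∣M∣ : 0 < ∣ M ∣
    0<∣M∣ = ℕ.n≢0⇒n>0 (λ ∣M∣≡0 → M≢0 (ℤ.∣i∣≡0⇒i≡0 ∣M∣≡0))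

  bounding⇒bounded : ∀ c e → 0 < modN c → Bounding P c → Satisfies Q c e → Q ^ e ≤ modN c
  bounding⇒bounded c@(L , M , N) e 0<N (M≢0 , ordM<ordN) sat =
    solution-bounded L e 0<N M≢0 ordM<ordN (satisfies⇒≡-mod c e sat)

  satisfies-shift-up : ∀ c e {f} → 0 < modN c → φ (modN c) ℕ∣.∣ f → ¬ Bounding P c →
                       Satisfies Q c e → Satisfies Q c (e + f)
  satisfies-shift-up c e {f} 0<N φ∣f ¬bounding sat = ≡-mod⇒satisfies c (e + f)
    (Cofactor.shift-up 0<N (lhsL c) e (¬bounding⇒P^ord∣rhs c 0<N ¬bounding) φ∣f (satisfies⇒≡-mod c e sat))

  satisfies-shift-down : ∀ c d {f} → 0 < modN c → φ (modN c) ℕ∣.∣ f → ¬ Bounding P c → modN c ≤ Q ^ d →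
                         Satisfies Q c (d + f) → Satisfies Q c d
  satisfies-shift-down c d {f} 0<N φ∣f ¬bounding N≤Q^d sat = ≡-mod⇒satisfies c d
    (Cofactor.shift-down 0<N (lhsL c) d (¬bounding⇒P^ord∣rhs c 0<N ¬bounding) φ∣f N≤Q^d
      (satisfies⇒≡-mod c (d + f) sat))

  module System {𝒩 : List ℕ} (𝒩-pos : All (0 <_) 𝒩)
                {sys : List Congruence} (sys⊆𝒩 : All (λ c → modN c ∈ 𝒩) sys) where

    Solves : ℕ → Set
    Solves e = All (λ c → Satisfies Q c e) sys

    solves? : Decidable Solves
    solves? e = All.all? (λ c → satisfies? c e) sys

    0<modN : ∀ {c} → c ∈ sys → 0 < modN c
    0<modN c∈ = All.lookup 𝒩-pos (All.lookup sys⊆𝒩 c∈)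

    modN≤max : ∀ {c} → c ∈ sys → modN c ≤ maxList 𝒩
    modN≤max c∈ = ∈⇒≤maxList (All.lookup sys⊆𝒩 c∈)

    φ[modN]∣f : ∀ {c} → c ∈ sys → φ (modN c) ℕ∣.∣ prodList (map φ 𝒩)
    φ[modN]∣f c∈ = ∈⇒∣product (∈-map⁺ φ (All.lookup sys⊆𝒩 c∈))

    solutions-bounded : Any (Bounding P) sys → ∀ e → Solves e → Q ^ e ≤ maxList 𝒩
    solutions-bounded bounding e sol with find bounding
    ... | c , c∈ , c-bounding =
      ℕ.≤-trans (bounding⇒bounded c e (0<modN c∈) c-bounding (All.lookup sol c∈)) (modN≤max c∈)

    solutions-finite : Any (Bounding P) sys → ∃ λ (S : List ℕ) → ∀ e → (Solves e ⇔ e ∈ S)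
    solutions-finite bounding = bounded⇒finite solves? (maxList 𝒩) λ e sol →
      ℕ.<⇒≤ (ℕ.<-≤-trans (n<m^n Q 1<Q e) (solutions-bounded bounding e sol))

    solutions-progressions : 𝒩 ≢ [] → ¬ Any (Bounding P) sys →
      ∃ λ (E : List ℕ) → All (λ e₀ → Q ^ e₀ < Q ^ prodList (map φ 𝒩) * maxList 𝒩) E ×
        (∀ e → (Solves e ⇔ Any (λ e₀ → ∃ λ t → e ≡ e₀ + t * prodList (map φ 𝒩)) E))
    solutions-progressions 𝒩≢[] ¬bounding = ultimately-periodic⇒progressions solves? 1<Q
      (0<prodList-φ 𝒩-pos) (0<maxList 𝒩-pos 𝒩≢[])
      (λ e sol → All.tabulate λ {c} c∈ →
        satisfies-shift-up c e (0<modN c∈) (φ[modN]∣f c∈) (¬bounding ∘ lose c∈) (All.lookup sol c∈))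
      (λ d max≤Q^d sol → All.tabulate λ {c} c∈ →
        satisfies-shift-down c d (0<modN c∈) (φ[modN]∣f c∈) (¬bounding ∘ lose c∈)
          (ℕ.≤-trans (modN≤max c∈) max≤Q^d) (All.lookup sol c∈))

lemma11p1 : (P Q : ℕ) → Prime P → (∃ λ k → Q ≡ P ^ k) → 1 < Q →
  (𝒩 : List ℕ) → Unique 𝒩 → All (λ N → 0 < N) 𝒩 → 𝒩 ≢ [] →
  (sys : List Congruence) → All (λ c → modN c ∈ 𝒩) sys →
  (∃ λ e → All (λ c → Satisfies Q c e) sys) →
  ((Any (λ c → (rhsM c ≢ Data.Integer.+ 0) × (ordℤ P (rhsM c) < ord P (modN c))) sys →
      (∃ λ (S : List ℕ) → ∀ e → (All (λ c → Satisfies Q c e) sys ⇔ e ∈ S))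
      × (∀ e → All (λ c → Satisfies Q c e) sys → Q ^ e ≤ maxList 𝒩))
   × (¬ Any (λ c → (rhsM c ≢ Data.Integer.+ 0) × (ordℤ P (rhsM c) < ord P (modN c))) sys →
      ∃ λ (E : List ℕ) →
        All (λ e₀ → Q ^ e₀ < Q ^ prodList (map φ 𝒩) * maxList 𝒩) E
        × (∀ e → (All (λ c → Satisfies Q c e) sys ⇔
                  Any (λ e₀ → ∃ λ t → e ≡ e₀ + t * prodList (map φ 𝒩)) E))))
lemma11p1 P Q P-prime (k , Q≡P^k) 1<Q 𝒩 _ 𝒩-pos 𝒩≢[] sys sys⊆𝒩 _ =
  (λ bounding → solutions-finite bounding , solutions-bounded bounding) ,
  solutions-progressions 𝒩≢[]
  where open PrimePower.System P-prime {k = k} Q≡P^k 1<Q 𝒩-pos sys⊆𝒩
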